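{- Let $k\geq 2$ and let $G\neq K_k$ be a $k$-tree. Let $SI$ be the set of simplicial vertices of $G$. Then $\tau(G-SI)\geq \tau(G)$.
   Context: A $k$-tree is defined inductively: the complete graph on $k+1$ vertices is a $k$-tree; if $G$ is a $k$-tree and $S$ is a $k$-clique of $G$, adding a new vertex adjacent exactly to the vertices of $S$ yields a $k$-tree; nothing else is a $k$-tree. A vertex is simplicial if its neighbourhood is a clique. For a graph $H$, $\omega(H)$ is its number of connected components. The toughness $\tau(H)$ of a non-complete graph $H$ is $\min |S|/\omega(H-S)$ over all vertex sets $S$ with $\omega(H-S)>1$; by convention $\tau(K_m)=\infty$ for $m\geq 1$. -}

module Defs where

open import Data.Nat using (ℕ; zero; suc; _*_; _≤_; _<_)
open import Data.Fin using (Fin; zero; suc)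
open import Data.Fin.Subset using (Subset; _∈_; _∉_; ∣_∣)
open import Data.Unit using (⊤)
open import Data.Bool using (Bool; true; false)
open import Data.Vec using (lookup)
open import Data.Product using (Σ; ∃; _×_; _,_)
open import Relation.Nullary using (¬_)
open import Relation.Binary.PropositionalEquality using (_≡_; _≢_)
open import Function.Bundles using (_↔_; Inverse)

Graph : ℕ → Set
Graph n = Fin n → Fin n → Bool

Edge : ∀ {n} → Graph n → Fin n → Fin n → Set
Edge G u v = G u v ≡ true

IsComplete : ∀ {n} → Graph n → Set
IsComplete G = ∀ u v → u ≢ v → Edge G u v

record _≅_ {n : ℕ} (G G' : Graph n) : Set where
  field
    σ   : Fin n ↔ Fin n
    pres : ∀ u v → G' (Inverse.to σ u) (Inverse.to σ v) ≡ G u v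

IsKClique : ∀ {n} → ℕ → Graph n → Subset n → Set
IsKClique k G S = (∣ S ∣ ≡ k) × (∀ u v → u ∈ S → v ∈ S → u ≢ v → Edge G u v)

extend : ∀ {n} → Graph n → Subset n → Graph (suc n)
extend G S zero    zero    = false
extend G S zero    (suc v) = lookup S v
extend G S (suc u) zero    = lookup S u
extend G S (suc u) (suc v) = G u v

-- k-trees (closed under isomorphism, as graphs are considered up to iso)
data KTree (k : ℕ) : (n : ℕ) → Graph n → Set where
  base : (G : Graph (suc k)) → IsComplete G → (∀ v → G v v ≡ false) → KTree k (suc k) G
  step : ∀ {n} {G : Graph n} (S : Subset n) → KTree k n G → IsKClique k G S →
         KTree k (suc n) (extend G S)
  iso  : ∀ {n} {G G' : Graph n} → KTree k n G → G ≅ G' → KTree k n G'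

Simplicial : ∀ {n} → Graph n → Fin n → Set
Simplicial G v = ∀ a b → Edge G v a → Edge G v b → a ≢ b → Edge G a b

data Reach {n} (G : Graph n) (W : Fin n → Set) (u : Fin n) : Fin n → Set where
  here : W u → Reach G W u u
  next : ∀ {v w} → Reach G W u v → W w → Edge G v w → Reach G W u w

-- the induced subgraph G[W] has exactly c connected components:
-- a surjective labelling of W by Fin c identifying exactly the connected pairs
HasComponents : ∀ {n} → Graph n → (Fin n → Set) → ℕ → Set
HasComponents {n} G W c =
  Σ ((v : Fin n) → W v → Fin c) λ f →
    (∀ i → ∃ λ v → Σ (W v) λ w → f v w ≡ i) ×
    (∀ u v (wu : W u) (wv : W v) →
       (f u wu ≡ f v wv → Reach G W u v) × (Reach G W u v → f u wu ≡ f v wv))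

Separator : ∀ {n} → Graph n → (Fin n → Set) → Subset n → ℕ → Set
Separator G U S c =
  (∀ v → v ∈ S → U v) × HasComponents G (λ v → U v × v ∉ S) c × (1 < c)

-- τ(G[U]) ≥ τ(G[V]), with τ = min |S|/ω over separators, τ(complete) = ∞
ToughnessGeq : ∀ {n} → Graph n → (Fin n → Set) → (Fin n → Set) → Set
ToughnessGeq G U V =
  ∀ S c → Separator G U S c →
    ∃ λ T → ∃ λ d → Separator G V T d × (∣ T ∣ * c ≤ ∣ S ∣ * d)

AllVertices : ∀ {n} → Fin n → Set
AllVertices _ = ⊤

-- Let SI be the set of simplicial vertices and Core = V(G) - SI.  Given a
-- separator S of G[Core] with c components, we show that S is also a
-- separator of G itself with d ≥ c components; then |S|/d ≤ |S|/c, which is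
-- the required inequality τ(G) ≤ τ(G - SI).  The heart of the argument is that
-- simplicial vertices can be bypassed: if two non-simplicial vertices are
-- joined by a walk in G - S, then a simplicial vertex w on it has both walk
-- neighbours in the clique N(w), so it can be skipped (bypass-simplicial).
-- Hence distinct components of G[Core] - S lie in distinct components of
-- G - S, and the components of G[Core] - S inject into those of G - S.
--
-- This works for every undirected graph; of the k-tree structure only the
-- symmetry of the adjacency relation is used (ktree-undirected).
module Submission where

open import Defs
open import Data.Nat using (ℕ; suc; _≤_)
open import Data.Nat.Properties using (<-≤-trans; *-monoʳ-≤)
open import Data.Fin using (Fin; zero; suc)
open import Data.Fin.Properties using (any?; all?; injective⇒≤; suc-injective)
  renaming (_≟_ to _≟ᶠ_)
open import Data.Fin.Subset using (_∉_; ∣_∣)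
open import Data.Fin.Subset.Properties using (_∈?_)
open import Data.Bool using (true)
open import Data.Bool.Properties using () renaming (_≟_ to _≟ᵇ_)
open import Data.Unit using (tt)
open import Data.Empty using (⊥-elim)
open import Data.Sum using (_⊎_; inj₁; inj₂)
open import Data.Product using (_×_; _,_; Σ; ∃; proj₁; proj₂; map₂)
open import Relation.Nullary using (¬_; Dec; yes; no)
open import Relation.Nullary.Decidable using (_×-dec_; _⊎-dec_; _→-dec_; ¬?; map′)
open import Relation.Binary.PropositionalEquality
  using (_≡_; refl; sym; trans; cong; cong₂; module ≡-Reasoning)
open import Function.Bundles using (Inverse)

Undirected : ∀ {n} → Graph n → Set
Undirected G = ∀ u v → G u v ≡ G v u

edge-sym : ∀ {n} {G : Graph n} → Undirected G → ∀ {u v} → Edge G u v → Edge G v u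
edge-sym undirected {u} {v} e = trans (undirected v u) e

-- Every k-tree is undirected: the base clique and each extension step are
-- symmetric, and symmetry is invariant under relabelling the vertices.
ktree-undirected : ∀ {k n} {G : Graph n} → KTree k n G → Undirected G
ktree-undirected (base G complete _) u v with u ≟ᶠ v
... | yes refl = refl
... | no u≢v   = trans (complete u v u≢v) (sym (complete v u (λ v≡u → u≢v (sym v≡u))))
ktree-undirected (step S t _) zero    zero    = refl
ktree-undirected (step S t _) zero    (suc v) = refl
ktree-undirected (step S t _) (suc u) zero    = refl
ktree-undirected (step S t _) (suc u) (suc v) = ktree-undirected t u v
ktree-undirected {G = G′} (iso {G = G} t G≅G′) u v = begin
  G′ u v                         ≡⟨ cong₂ G′ (sym (to∘from u)) (sym (to∘from v)) ⟩
  G′ (to (from u)) (to (from v)) ≡⟨ pres (from u) (from v) ⟩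
  G (from u) (from v)            ≡⟨ ktree-undirected t (from u) (from v) ⟩
  G (from v) (from u)            ≡⟨ sym (pres (from v) (from u)) ⟩
  G′ (to (from v)) (to (from u)) ≡⟨ cong₂ G′ (to∘from v) (to∘from u) ⟩
  G′ v u                         ∎
  where
  open ≡-Reasoning
  open _≅_ G≅G′
  open Inverse σ using (to; from) renaming (strictlyInverseˡ to to∘from)

module _ {n} {G : Graph n} where

  reach-source : ∀ {W u v} → Reach G W u v → W u
  reach-source (here wu)     = wu
  reach-source (next r _ _)  = reach-source r

  reach-target : ∀ {W u v} → Reach G W u v → W v
  reach-target (here wv)     = wv
  reach-target (next _ wv _) = wv

  reach-trans : ∀ {W u v w} → Reach G W u v → Reach G W v w → Reach G W u w
  reach-trans r (here _)      = r
  reach-trans r (next s ww e) = next (reach-trans r s) ww e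

  reach-mono : ∀ {A B : Fin n → Set} {u v} → (∀ x → A x → B x) → Reach G A u v → Reach G B u v
  reach-mono A⊆B (here au)     = here (A⊆B _ au)
  reach-mono A⊆B (next r aw e) = next (reach-mono A⊆B r) (A⊆B _ aw) e

  reach-sym : Undirected G → ∀ {W u v} → Reach G W u v → Reach G W v u
  reach-sym undirected (here wu)     = here wu
  reach-sym undirected (next r ww e) =
    reach-trans (next (here ww) (reach-target r) (edge-sym undirected e)) (reach-sym undirected r)

  reach-closed-neighbour : ∀ {W u v} → W u → W v → u ≡ v ⊎ Edge G u v → Reach G W u v
  reach-closed-neighbour wu wv (inj₁ refl) = here wu
  reach-closed-neighbour wu wv (inj₂ e)    = next (here wu) wv e

-- A labelling of the elements of P by Fin m, onto, whose fibres are exactly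
-- the R-classes.  For R = Reach G W this is literally HasComponents G W m.
ClassLabelling : ∀ {n} → (Fin n → Set) → (Fin n → Fin n → Set) → ℕ → Set
ClassLabelling {n} P R m =
  Σ ((v : Fin n) → P v → Fin m) λ f →
    (∀ i → ∃ λ v → Σ (P v) λ pv → f v pv ≡ i) ×
    (∀ u v (pu : P u) (pv : P v) → (f u pu ≡ f v pv → R u v) × (R u v → f u pu ≡ f v pv))

record IsEquivalenceOn {n} (P : Fin n → Set) (R : Fin n → Fin n → Set) : Set where
  field
    reflexive  : ∀ v → P v → R v v
    symmetric  : ∀ {u v} → R u v → R v u
    transitive : ∀ {u v w} → R u v → R v w → R u w

-- One step of building a class labelling of P on Fin (suc n) from one of the
-- restriction of P and R to the vertices suc v, according to the status of
-- vertex zero.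
module ExtendLabelling {n} (P : Fin (suc n) → Set) (R : Fin (suc n) → Fin (suc n) → Set) where

  P⁺ : Fin n → Set
  P⁺ v = P (suc v)

  R⁺ : Fin n → Fin n → Set
  R⁺ u v = R (suc u) (suc v)

  restrict : IsEquivalenceOn P R → IsEquivalenceOn P⁺ R⁺
  restrict eq = record { reflexive = λ v → reflexive (suc v) ; symmetric = symmetric ; transitive = transitive }
    where open IsEquivalenceOn eq

  skip-zero : ∀ {m} → ¬ P zero → ClassLabelling P⁺ R⁺ m → ClassLabelling P R m
  skip-zero {m} ¬p0 (h , onto , fibres) = label , onto′ , fibres′
    where
    label : (v : Fin (suc n)) → P v → Fin m
    label zero    p = ⊥-elim (¬p0 p)
    label (suc v) p = h v p
    onto′ : ∀ i → ∃ λ v → Σ (P v) λ pv → label v pv ≡ i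
    onto′ i with onto i
    ... | v , pv , e = suc v , pv , e
    fibres′ : ∀ u v (pu : P u) (pv : P v) → (label u pu ≡ label v pv → R u v) × (R u v → label u pu ≡ label v pv)
    fibres′ zero    _       pu _  = ⊥-elim (¬p0 pu)
    fibres′ (suc u) zero    _  pv = ⊥-elim (¬p0 pv)
    fibres′ (suc u) (suc v) pu pv = fibres u v pu pv

  join-zero : ∀ {m} → IsEquivalenceOn P R → (w : Fin n) → P⁺ w → R zero (suc w) →
              ClassLabelling P⁺ R⁺ m → ClassLabelling P R m
  join-zero {m} eq w pw r (h , onto , fibres) = label , onto′ , fibres′
    where
    open IsEquivalenceOn eq
    label : (v : Fin (suc n)) → P v → Fin m
    label zero    _ = h w pw
    label (suc v) p = h v p
    onto′ : ∀ i → ∃ λ v → Σ (P v) λ pv → label v pv ≡ i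
    onto′ i with onto i
    ... | v , pv , e = suc v , pv , e
    fibres′ : ∀ u v (pu : P u) (pv : P v) → (label u pu ≡ label v pv → R u v) × (R u v → label u pu ≡ label v pv)
    fibres′ zero    zero    pu _  = (λ _ → reflexive zero pu) , (λ _ → refl)
    fibres′ zero    (suc v) _  pv =
      (λ e → transitive r (proj₁ (fibres w v pw pv) e)) ,
      (λ r′ → proj₂ (fibres w v pw pv) (transitive (symmetric r) r′))
    fibres′ (suc u) zero    pu _  =
      (λ e → symmetric (transitive r (proj₁ (fibres w u pw pu) (sym e)))) ,
      (λ r′ → sym (proj₂ (fibres w u pw pu) (transitive (symmetric r) (symmetric r′))))
    fibres′ (suc u) (suc v) pu pv = fibres u v pu pv

  fresh-zero : ∀ {m} → IsEquivalenceOn P R → P zero → (∀ w → P⁺ w → ¬ R zero (suc w)) →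
               ClassLabelling P⁺ R⁺ m → ClassLabelling P R (suc m)
  fresh-zero {m} eq p0 alone (h , onto , fibres) = label , onto′ , fibres′
    where
    open IsEquivalenceOn eq
    label : (v : Fin (suc n)) → P v → Fin (suc m)
    label zero    _ = zero
    label (suc v) p = suc (h v p)
    onto′ : ∀ i → ∃ λ v → Σ (P v) λ pv → label v pv ≡ i
    onto′ zero = zero , p0 , refl
    onto′ (suc i) with onto i
    ... | v , pv , e = suc v , pv , cong suc e
    fibres′ : ∀ u v (pu : P u) (pv : P v) → (label u pu ≡ label v pv → R u v) × (R u v → label u pu ≡ label v pv)
    fibres′ zero    zero    pu _  = (λ _ → reflexive zero pu) , (λ _ → refl)
    fibres′ zero    (suc v) _  pv = (λ ()) , (λ r → ⊥-elim (alone v pv r))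
    fibres′ (suc u) zero    pu _  = (λ ()) , (λ r → ⊥-elim (alone u pu (symmetric r)))
    fibres′ (suc u) (suc v) pu pv =
      (λ e → proj₁ (fibres u v pu pv) (suc-injective e)) ,
      (λ r → cong suc (proj₂ (fibres u v pu pv) r))

class-labelling : ∀ n (P : Fin n → Set) (R : Fin n → Fin n → Set) →
                  (∀ v → Dec (P v)) → (∀ u v → Dec (R u v)) → IsEquivalenceOn P R →
                  ∃ λ m → ClassLabelling P R m
class-labelling 0 P R P? R? eq = 0 , (λ ()) , (λ ()) , (λ ())
class-labelling (suc n) P R P? R? eq
  with class-labelling n (λ v → P (suc v)) (λ u v → R (suc u) (suc v))
                       (λ v → P? (suc v)) (λ u v → R? (suc u) (suc v)) (ExtendLabelling.restrict P R eq)
     | P? zero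
     | any? (λ w → P? (suc w) ×-dec R? zero (suc w))
... | m , tail | no ¬p0 | _                = m , ExtendLabelling.skip-zero P R ¬p0 tail
... | m , tail | yes _  | yes (w , pw , r) = m , ExtendLabelling.join-zero P R eq w pw r tail
... | m , tail | yes p0 | no ¬joined       =
  suc m , ExtendLabelling.fresh-zero P R eq p0 (λ w pw r → ¬joined (w , pw , r)) tail

labelling-decides : ∀ {n m} {P : Fin n → Set} {R : Fin n → Fin n → Set} →
                    ClassLabelling P R m → (∀ v → Dec (P v)) →
                    (∀ {u v} → R u v → P u × P v) → ∀ u v → Dec (R u v)
labelling-decides (f , _ , fibres) P? R⊆P u v with P? u | P? v
... | yes pu | yes pv = map′ (proj₁ (fibres u v pu pv)) (proj₂ (fibres u v pu pv)) (f u pu ≟ᶠ f v pv)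
... | no ¬pu | _      = no (λ r → ¬pu (proj₁ (R⊆P r)))
... | yes _  | no ¬pv = no (λ r → ¬pv (proj₂ (R⊆P r)))

-- If P ⊆ Q and, on P, R′ refines R, then Q has at least as many R′-classes as
-- P has R-classes: the map sending an R-class to the R′-class of any of its
-- members is injective.
labelling-≤ : ∀ {n c d} {P Q : Fin n → Set} {R R′ : Fin n → Fin n → Set} →
              (P⊆Q : ∀ v → P v → Q v) → (∀ {u v} → P u → P v → R′ u v → R u v) →
              ClassLabelling P R c → ClassLabelling Q R′ d → c ≤ d
labelling-≤ {P = P} {Q} P⊆Q refines (f , onto , fibres) (h , _ , fibres′) = injective⇒≤ g-injective
  where
  g : Fin _ → Fin _
  g i with onto i
  ... | v , pv , _ = h v (P⊆Q v pv)
  g-injective : ∀ {i j} → g i ≡ g j → i ≡ j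
  g-injective {i} {j} gi≡gj with onto i | onto j
  ... | u , pu , refl | v , pv , refl =
    proj₂ (fibres u v pu pv) (refines pu pv (proj₁ (fibres′ u v (P⊆Q u pu) (P⊆Q v pv)) gi≡gj))

module _ {n} (G : Graph n) where

  edge? : ∀ u v → Dec (Edge G u v)
  edge? u v = G u v ≟ᵇ true

  simplicial? : ∀ v → Dec (Simplicial G v)
  simplicial? v = all? λ a → all? λ b →
    edge? v a →-dec (edge? v b →-dec (¬? (a ≟ᶠ b) →-dec edge? a b))

simplicial-neighbours : ∀ {n} {G : Graph n} {w a b} → Simplicial G w → Edge G w a → Edge G w b →
                        a ≡ b ⊎ Edge G a b
simplicial-neighbours {a = a} {b} sw wa wb with a ≟ᶠ b
... | yes a≡b = inj₁ a≡b
... | no a≢b  = inj₂ (sw a b wa wb a≢b)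

module Bypass {n} (G : Graph n) (undirected : Undirected G)
              (W Core : Fin n → Set) (Core⊆W : ∀ v → Core v → W v)
              (nonsimplicial⊆Core : ∀ v → W v → ¬ Simplicial G v → Core v) where

  Anchor : Fin n → Fin n → Set
  Anchor v p = Core p × (p ≡ v ⊎ Edge G p v)

  -- Every vertex reachable in G[W] from a core vertex p has an anchor that
  -- is reachable from p inside G[Core]: along the walk, a simplicial vertex
  -- keeps the previous anchor, a non-simplicial one becomes the new anchor.
  anchored-reach : ∀ {p v} → Core p → Reach G W p v → ∃ λ x → Reach G Core p x × Anchor v x
  anchored-reach cp (here _) = _ , here cp , cp , inj₁ refl
  anchored-reach cp (next {v} {w} r ww vw) with anchored-reach cp r
  ... | x , px , cx , inj₁ refl = x , px , cx , inj₂ vw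
  ... | x , px , cx , inj₂ xv with simplicial? G v
  ...   | yes sv = x , px , cx , simplicial-neighbours sv (edge-sym undirected xv) vw
  ...   | no ¬sv = v , next px cv xv , cv , inj₂ vw
    where
    cv : Core v
    cv = nonsimplicial⊆Core v (reach-target r) ¬sv

  bypass-simplicial : ∀ {p q} → Core p → Core q → Reach G W p q → Reach G Core p q
  bypass-simplicial cp cq r with anchored-reach cp r
  ... | _ , px , _ , inj₁ refl = px
  ... | _ , px , _ , inj₂ xq   = next px cq xq

  -- An orphan (a vertex without anchor) only reaches its closed
  -- neighbourhood: each vertex on its walks is simplicial, as a non-simplicial
  -- one adjacent to the orphan would be its anchor.
  orphan-reach : ∀ {u v} → (∀ p → ¬ Anchor u p) → Reach G W u v → u ≡ v ⊎ Edge G u v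
  orphan-reach orphan (here _) = inj₁ refl
  orphan-reach orphan (next {v} r ww vw) with orphan-reach orphan r
  ... | inj₁ refl = inj₂ vw
  ... | inj₂ uv with simplicial? G v
  ...   | yes sv = simplicial-neighbours sv (edge-sym undirected uv) vw
  ...   | no ¬sv = ⊥-elim (orphan v (nonsimplicial⊆Core v (reach-target r) ¬sv , inj₂ (edge-sym undirected uv)))

  anchor-reach : ∀ {v p} → W v → Anchor v p → Reach G W p v
  anchor-reach wv (cp , near) = reach-closed-neighbour (Core⊆W _ cp) wv near

  -- Reachability in G[W] is decidable once it is decidable in G[Core]:
  -- anchored vertices are connected iff their anchors are connected in the
  -- core, anchored and orphan vertices are never connected, and orphans are
  -- connected iff they are equal or adjacent.
  reach? : (∀ v → Dec (W v)) → (∀ v → Dec (Core v)) →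
           (∀ p q → Dec (Reach G Core p q)) → ∀ u v → Dec (Reach G W u v)
  reach? W? Core? core-reach? u v with W? u | W? v
  ... | no ¬wu | _      = no (λ r → ¬wu (reach-source r))
  ... | yes _  | no ¬wv = no (λ r → ¬wv (reach-target r))
  ... | yes wu | yes wv with anchor? u | anchor? v
    where
    anchor? : ∀ x → Dec (∃ λ p → Anchor x p)
    anchor? x = any? λ p → Core? p ×-dec ((p ≟ᶠ x) ⊎-dec edge? G p x)
  ... | yes (p , ap) | yes (q , aq) = map′ from-core to-core (core-reach? p q)
    where
    up : Reach G W u p
    up = reach-sym undirected (anchor-reach wu ap)
    from-core : Reach G Core p q → Reach G W u v
    from-core r = reach-trans up (reach-trans (reach-mono Core⊆W r) (anchor-reach wv aq))
    to-core : Reach G W u v → Reach G Core p q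
    to-core r = bypass-simplicial (proj₁ ap) (proj₁ aq)
      (reach-trans (anchor-reach wu ap) (reach-trans r (reach-sym undirected (anchor-reach wv aq))))
  ... | yes (p , ap) | no ¬av = no λ r →
    ¬av (map₂ proj₂ (anchored-reach (proj₁ ap) (reach-trans (anchor-reach wu ap) r)))
  ... | no ¬au | yes (q , aq) = no λ r →
    ¬au (map₂ proj₂ (anchored-reach (proj₁ aq) (reach-trans (anchor-reach wv aq) (reach-sym undirected r))))
  ... | no ¬au | no _ =
    map′ (reach-closed-neighbour wu wv) (orphan-reach (λ p ap → ¬au (p , ap))) ((u ≟ᶠ v) ⊎-dec edge? G u v)

  components-≤ : (∀ v → Dec (W v)) → (∀ v → Dec (Core v)) → ∀ {c} → HasComponents G Core c →
                 ∃ λ d → HasComponents G W d × c ≤ d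
  components-≤ W? Core? core-components with
    class-labelling n W (Reach G W) W? (reach? W? Core? core-reach?) reach-equivalence
    where
    core-reach? : ∀ p q → Dec (Reach G Core p q)
    core-reach? = labelling-decides core-components Core? (λ r → reach-source r , reach-target r)
    reach-equivalence : IsEquivalenceOn W (Reach G W)
    reach-equivalence = record
      { reflexive = λ _ → here ; symmetric = reach-sym undirected ; transitive = reach-trans }
  ... | d , components = d , components , labelling-≤ Core⊆W bypass-simplicial core-components components

separator-of-nonsimplicial : ∀ {n} (G : Graph n) → Undirected G → ∀ S {c} →
  HasComponents G (λ v → ¬ Simplicial G v × v ∉ S) c →
  ∃ λ d → HasComponents G (λ v → AllVertices v × v ∉ S) d × c ≤ d
separator-of-nonsimplicial G undirected S =
  components-≤ (λ v → yes tt ×-dec ¬? (v ∈? S)) (λ v → ¬? (simplicial? G v) ×-dec ¬? (v ∈? S))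
  where
  open Bypass G undirected (λ v → AllVertices v × v ∉ S) (λ v → ¬ Simplicial G v × v ∉ S)
              (λ _ core → tt , proj₂ core) (λ _ w ¬simplicial → ¬simplicial , proj₂ w)

mainTheorem2 : (k n : ℕ) → 2 ≤ k → (G : Graph n) → KTree k n G →
               ¬ ((n ≡ k) × IsComplete G) →
               ToughnessGeq G (λ v → ¬ Simplicial G v) AllVertices
mainTheorem2 k n _ G ktree _ S c (_ , core-components , 1<c)
  with separator-of-nonsimplicial G (ktree-undirected ktree) S core-components
... | d , components , c≤d =
  S , d , ((λ _ _ → tt) , components , <-≤-trans 1<c c≤d) , *-monoʳ-≤ ∣ S ∣ c≤d
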